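{- Let $n\ge 2$, $m\ge 2$, and let $f\colon V(P_m)\to V(P_n)$ be any function. Then $P_m\otimes_f P_n$ is a tree $T$ that contains a path $v_1v_2\cdots v_k$ such that $T$ is the union of this path together with, for each $i\in[k]$, at most two paths starting at $v_i$, where all these attached paths are pairwise disjoint except at their starting vertices and meet the path $v_1\cdots v_k$ only in their starting vertex.
   Context: For graphs $G$ and $H$ and a function $f\colon V(G)\to V(H)$, the Sierpiński product $G\otimes_f H$ is the graph with vertex set $V(G)\times V(H)$ whose edges are: $(g,h)(g,h')$ for every $g\in V(G)$ and every edge $hh'\in E(H)$; and $(g,f(g'))(g',f(g))$ for every edge $gg'\in E(G)$. $P_m$ denotes the path on $m$ vertices. -}

module Defs where

open import Data.Nat using (ℕ; suc; _≤_)
open import Data.Fin using (Fin; toℕ)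
open import Data.Product using (Σ; _×_; _,_; proj₁; proj₂)
open import Data.Sum using (_⊎_)
open import Data.List using (List; []; _∷_; _++_; length; lookup; concat; tabulate)
open import Data.List.Relation.Unary.Linked using (Linked)
open import Data.List.Relation.Unary.Unique.Propositional using (Unique)
open import Data.List.Membership.Propositional using (_∈_)
open import Relation.Binary.PropositionalEquality using (_≡_)
open import Relation.Nullary using (¬_)

record Graph : Set₁ where
  field
    V : Set
    E : V → V → Set
open Graph public

P : ℕ → Graph
V (P m) = Fin m
E (P m) i j = (suc (toℕ i) ≡ toℕ j) ⊎ (suc (toℕ j) ≡ toℕ i)

Sierpinski : (G H : Graph) → (V G → V H) → Graph
V (Sierpinski G H f) = V G × V H
E (Sierpinski G H f) (g , h) (g' , h') =
  ((g ≡ g') × E H h h') ⊎ (E G g g' × ((h ≡ f g') × (h' ≡ f g)))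

module _ (G : Graph) where

  lastFrom : V G → List (V G) → V G
  lastFrom x [] = x
  lastFrom x (y ∷ ys) = lastFrom y ys

  IsPath : List (V G) → Set
  IsPath xs = Linked (E G) xs × Unique xs

  Connected : Set
  Connected = (u v : V G) →
    Σ (List (V G)) λ xs → Linked (E G) (u ∷ xs) × (lastFrom u xs ≡ v)

  IsCycle : V G → List (V G) → Set
  IsCycle x xs = (2 ≤ length xs) × IsPath (x ∷ xs) × E G (lastFrom x xs) x

  Acyclic : Set
  Acyclic = (x : V G) (xs : List (V G)) → ¬ IsCycle x xs

  IsTree : Set
  IsTree = Connected × Acyclic

  Consec : List (V G) → V G → V G → Set
  Consec xs u v = Σ (List (V G)) λ ys → Σ (List (V G)) λ zs → xs ≡ ys ++ (u ∷ v ∷ zs)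

  EdgeOfPath : List (V G) → V G → V G → Set
  EdgeOfPath xs u v = Consec xs u v ⊎ Consec xs v u

  -- Spine v_1…v_k (the nonempty list s) together with, for each i, two
  -- (possibly trivial) attached paths  v_i ∷ t₁  and  v_i ∷ t₂  (given by
  -- their tails t₁, t₂).  A trivial path (empty tail) means "no path",
  -- so this encodes "at most two paths starting at v_i".
  -- Conditions: all are paths of G; the spine together with all tails is
  -- a duplicate-free list (attached paths pairwise disjoint except at their
  -- starting vertices and meeting the spine only there); and G is the union
  -- of these paths (every vertex and every edge of G lies on one of them).
  SpineDecomposition : Set
  SpineDecomposition =
    Σ (List (V G)) λ s →
    Σ (Fin (length s) → List (V G) × List (V G)) λ legs →
      let leg₁ = λ i → lookup s i ∷ proj₁ (legs i)
          leg₂ = λ i → lookup s i ∷ proj₂ (legs i)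
          allV = s ++ concat (tabulate (λ i → proj₁ (legs i) ++ proj₂ (legs i)))
      in  (1 ≤ length s)
        × IsPath s
        × ((i : Fin (length s)) → IsPath (leg₁ i) × IsPath (leg₂ i))
        × Unique allV
        × ((v : V G) → v ∈ allV)
        × ((u v : V G) → E G u v →
             EdgeOfPath s u v
             ⊎ Σ (Fin (length s)) λ i → EdgeOfPath (leg₁ i) u v ⊎ EdgeOfPath (leg₂ i) u v)

{-# OPTIONS --safe #-}
-- Copy g of P_n meets copy g + 1 only in the edge (g , f (g + 1)) (g + 1 , f g).  So the spine
-- runs through each copy g along P_n between its two ports f (g − 1) and f (g + 1) and crosses
-- that edge to the next copy; what remains of copy g are the vertical paths below the lower
-- port and above the upper one, which are the legs attached at the ports.
-- The product is a tree because ranking (g , h) by its distance to the end (0 , f 0) of the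
-- spine gives every other vertex exactly one neighbour of smaller rank: a vertex of maximal
-- rank on a cycle would have two, and following smaller ranks leads to (0 , f 0).
-- Everything is built in P∞ ⊗ P∞ on ℕ × ℕ and transported to Fin m × Fin n along toℕ.
module Submission where

open import Defs
open import Data.Nat
  using (ℕ; zero; suc; pred; _+_; _≤_; _<_; _⊓_; _⊔_; ∣_-_∣; z≤n; s≤s; s≤s⁻¹; _≟_; _<?_; _≤?_)
open import Data.Nat.Properties
open import Data.Fin using (Fin; toℕ; fromℕ<)
open import Data.Fin.Properties using (toℕ<n; toℕ≤pred[n]; toℕ-fromℕ<; fromℕ<-toℕ)
open import Data.Product using (Σ; _×_; _,_; proj₁; proj₂)
import Data.Product as Product
open import Data.Sum using (_⊎_; inj₁; inj₂)
import Data.Sum as Sum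
open import Data.Empty using (⊥; ⊥-elim)
open import Data.Unit using (⊤; tt)
open import Data.List using (List; []; _∷_; _++_; length; map; concat; tabulate; lookup)
open import Data.List.Properties
  using (++-assoc; ++-identityʳ; map-++; length-map; map-∘; map-id-local; map-cong-local; map-tabulate;
         tabulate-lookup; concat-map)
open import Data.List.Relation.Unary.All as All using (All; []; _∷_)
import Data.List.Relation.Unary.All.Properties as AllProp
open import Data.List.Relation.Unary.AllPairs as AllPairs using ([]; _∷_)
import Data.List.Relation.Unary.AllPairs.Properties as AllPairsProp
open import Data.List.Relation.Unary.Any as Any using (here; there)
open import Data.List.Relation.Unary.Any.Properties using (lookup-index)
open import Data.List.Relation.Unary.Linked as Linked using (Linked; []; [-]; _∷_)
import Data.List.Relation.Unary.Linked.Properties as Linked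
open import Data.List.Relation.Unary.Unique.Propositional using (Unique)
import Data.List.Relation.Unary.Unique.Propositional.Properties as Unique
open import Data.List.Membership.Propositional using (_∈_)
open import Data.List.Membership.Propositional.Properties
  using (∈-map⁺; ∈-map⁻; ∈-++⁺ˡ; ∈-++⁺ʳ; ∈-++⁻; ∈-concat⁺′; ∈-concat⁻′; ∈-lookup)
open import Relation.Binary.PropositionalEquality
  using (_≡_; _≢_; refl; sym; trans; cong; cong₂; subst; subst₂; module ≡-Reasoning)
open import Function using (_∘_; _∘′_)
open import Relation.Binary.Construct.Closure.ReflexiveTransitive using (Star; ε; _◅_; _◅◅_)
import Relation.Binary.Construct.Closure.ReflexiveTransitive as Star
open import Relation.Binary.Definitions using (Symmetric; tri<; tri≈; tri>)
open import Relation.Nullary using (¬_; yes; no)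

module _ (G H : Graph) (f : V G → V H) where

  Consec-map : ∀ {xs u v} → Consec G xs u v → Consec H (map f xs) (f u) (f v)
  Consec-map (ys , zs , refl) = map f ys , map f zs , map-++ f ys _

  EdgeOfPath-map : ∀ {xs u v} → EdgeOfPath G xs u v → EdgeOfPath H (map f xs) (f u) (f v)
  EdgeOfPath-map = Sum.map Consec-map Consec-map

  lastFrom-map : ∀ a xs → lastFrom H (f a) (map f xs) ≡ f (lastFrom G a xs)
  lastFrom-map a []       = refl
  lastFrom-map a (b ∷ xs) = lastFrom-map b xs

module _ (G : Graph) where

  Consec-++ˡ : ∀ xs {ys u v} → Consec G ys u v → Consec G (xs ++ ys) u v
  Consec-++ˡ xs (ys , zs , refl) = xs ++ ys , zs , sym (++-assoc xs ys _)

  Consec-++ʳ : ∀ {xs} ys {u v} → Consec G xs u v → Consec G (xs ++ ys) u v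
  Consec-++ʳ ys (xs , zs , refl) = xs , zs ++ ys , ++-assoc xs _ ys

  EdgeOfPath-∷ : ∀ x {xs u v} → EdgeOfPath G xs u v → EdgeOfPath G (x ∷ xs) u v
  EdgeOfPath-∷ x = Sum.map (Consec-++ˡ (x ∷ [])) (Consec-++ˡ (x ∷ []))

  EdgeOfPath-++ˡ : ∀ xs {ys u v} → EdgeOfPath G ys u v → EdgeOfPath G (xs ++ ys) u v
  EdgeOfPath-++ˡ xs = Sum.map (Consec-++ˡ xs) (Consec-++ˡ xs)

  EdgeOfPath-++ʳ : ∀ {xs} ys {u v} → EdgeOfPath G xs u v → EdgeOfPath G (xs ++ ys) u v
  EdgeOfPath-++ʳ ys = Sum.map (Consec-++ʳ ys) (Consec-++ʳ ys)

  EdgeOfPath-sym : ∀ {xs u v} → EdgeOfPath G xs u v → EdgeOfPath G xs v u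
  EdgeOfPath-sym = Sum.swap

  Consec-last : ∀ a as {b bs} → Consec G (a ∷ as ++ b ∷ bs) (lastFrom G a as) b
  Consec-last a []       = [] , _ , refl
  Consec-last a (c ∷ as) with ys , zs , eq ← Consec-last c as = a ∷ ys , zs , cong (a ∷_) eq

  Star⇒walk : ∀ {u v} → Star (E G) u v →
              Σ (List (V G)) λ xs → Linked (E G) (u ∷ xs) × lastFrom G u xs ≡ v
  Star⇒walk ε = [] , [-] , refl
  Star⇒walk (e ◅ es) with xs , linked , last ← Star⇒walk es = _ ∷ xs , e ∷ linked , last

  Linked-++ : ∀ {R : V G → V G → Set} {a as b bs} →
              Linked R (a ∷ as) → R (lastFrom G a as) b → Linked R (b ∷ bs) →
              Linked R (a ∷ as ++ b ∷ bs)
  Linked-++ [-]        r rest = r ∷ rest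
  Linked-++ (r′ ∷ rs) r rest = r′ ∷ Linked-++ rs r rest

ℕ-path : Graph
V ℕ-path = ℕ
E ℕ-path x y = suc x ≡ y ⊎ suc y ≡ x

-- a ⋯ b is the monotone path a , a ± 1 , … , b in ℕ, and towards a b its tail.
towards : ℕ → ℕ → List ℕ
towards zero    zero    = []
towards zero    (suc b) = map suc (0 ∷ towards 0 b)
towards (suc a) zero    = a ∷ towards a 0
towards (suc a) (suc b) = map suc (towards a b)

infix 5 _⋯_
_⋯_ : ℕ → ℕ → List ℕ
a ⋯ b = a ∷ towards a b

private
  suc-linked : ∀ {xs} → Linked (E ℕ-path) xs → Linked (E ℕ-path) (map suc xs)
  suc-linked = Linked.map⁺ ∘′ Linked.map (Sum.map (cong suc) (cong suc))

⋯-linked : ∀ a b → Linked (E ℕ-path) (a ⋯ b)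
⋯-linked zero    zero    = [-]
⋯-linked zero    (suc b) = inj₁ refl ∷ suc-linked (⋯-linked 0 b)
⋯-linked (suc a) zero    = inj₂ refl ∷ ⋯-linked a 0
⋯-linked (suc a) (suc b) = suc-linked (⋯-linked a b)

∈-⋯⁻ : ∀ a b {z} → z ∈ a ⋯ b → a ⊓ b ≤ z × z ≤ a ⊔ b
∈-⋯⁻ zero    zero    (here refl) = z≤n , z≤n
∈-⋯⁻ zero    (suc b) (here refl) = z≤n , z≤n
∈-⋯⁻ zero    (suc b) (there p) with z , z∈ , refl ← ∈-map⁻ suc p = z≤n , s≤s (proj₂ (∈-⋯⁻ 0 b z∈))
∈-⋯⁻ (suc a) zero    (here refl) = z≤n , ≤-refl
∈-⋯⁻ (suc a) zero    (there p)   =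
  z≤n , m≤n⇒m≤1+n (subst (_ ≤_) (⊔-identityʳ a) (proj₂ (∈-⋯⁻ a 0 p)))
∈-⋯⁻ (suc a) (suc b) p with z , z∈ , refl ← ∈-map⁻ suc p = Product.map s≤s s≤s (∈-⋯⁻ a b z∈)

∈-⋯⁺ : ∀ a b {z} → a ⊓ b ≤ z → z ≤ a ⊔ b → z ∈ a ⋯ b
∈-⋯⁺ zero    zero    {zero}  _ _         = here refl
∈-⋯⁺ zero    (suc b) {zero}  _ _         = here refl
∈-⋯⁺ zero    (suc b) {suc z} _ (s≤s z≤b) = there (∈-map⁺ suc (∈-⋯⁺ 0 b z≤n z≤b))
∈-⋯⁺ (suc a) zero    {z}     _ z≤1+a with m≤n⇒m<n∨m≡n z≤1+a
... | inj₂ refl      = here refl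
... | inj₁ (s≤s z≤a) = there (∈-⋯⁺ a 0 (≤-trans (m⊓n≤n a 0) z≤n) (≤-trans z≤a (m≤m⊔n a 0)))
∈-⋯⁺ (suc a) (suc b) {suc z} (s≤s l) (s≤s r) = ∈-map⁺ suc (∈-⋯⁺ a b l r)

⋯-unique : ∀ a b → Unique (a ⋯ b)
⋯-unique zero    zero    = [] ∷ []
⋯-unique zero    (suc b) = All.tabulate 0∉ ∷ Unique.map⁺ suc-injective (⋯-unique 0 b)
  where
  0∉ : ∀ {z} → z ∈ map suc (0 ⋯ b) → 0 ≢ z
  0∉ p refl with _ , _ , () ← ∈-map⁻ suc p
⋯-unique (suc a) zero    = All.tabulate (λ p eq → 1+n≰n (subst (_≤ a) (sym eq) (above p))) ∷ ⋯-unique a 0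
  where
  above : ∀ {z} → z ∈ a ⋯ 0 → z ≤ a
  above p = subst (_ ≤_) (⊔-identityʳ a) (proj₂ (∈-⋯⁻ a 0 p))
⋯-unique (suc a) (suc b) = Unique.map⁺ suc-injective (⋯-unique a b)

∈-towards⁻ : ∀ a b {z} → z ∈ towards a b → (a ⊓ b ≤ z × z ≤ a ⊔ b) × z ≢ a
∈-towards⁻ a b p with a∉ ∷ _ ← ⋯-unique a b = ∈-⋯⁻ a b (there p) , λ z≡a → All.lookup a∉ p (sym z≡a)

∈-towards⁺ : ∀ a b {z} → a ⊓ b ≤ z → z ≤ a ⊔ b → z ≢ a → z ∈ towards a b
∈-towards⁺ a b l r z≢a with ∈-⋯⁺ a b l r
... | here z≡a = ⊥-elim (z≢a z≡a)
... | there p  = p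

lastFrom-⋯ : ∀ a b → lastFrom ℕ-path a (towards a b) ≡ b
lastFrom-⋯ zero    zero    = refl
lastFrom-⋯ zero    (suc b) = trans (lastFrom-map ℕ-path ℕ-path suc 0 (towards 0 b)) (cong suc (lastFrom-⋯ 0 b))
lastFrom-⋯ (suc a) zero    = lastFrom-⋯ a 0
lastFrom-⋯ (suc a) (suc b) = trans (lastFrom-map ℕ-path ℕ-path suc a (towards a b)) (cong suc (lastFrom-⋯ a b))

⋯-edge : ∀ a b {z} → a ⊓ b ≤ z → suc z ≤ a ⊔ b → EdgeOfPath ℕ-path (a ⋯ b) z (suc z)
⋯-edge zero    (suc b) {zero}  _ _          = inj₁ ([] , _ , refl)
⋯-edge zero    (suc b) {suc z} _ (s≤s z<b)  =
  EdgeOfPath-∷ ℕ-path 0 (EdgeOfPath-map ℕ-path ℕ-path suc (⋯-edge 0 b z≤n z<b))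
⋯-edge (suc a) zero    {z}     _ (s≤s z≤a) with m≤n⇒m<n∨m≡n z≤a
... | inj₂ refl = inj₂ ([] , _ , refl)
... | inj₁ z<a  =
  EdgeOfPath-∷ ℕ-path (suc a) (⋯-edge a 0 (≤-trans (m⊓n≤n a 0) z≤n) (≤-trans z<a (m≤m⊔n a 0)))
⋯-edge (suc a) (suc b) {suc z} (s≤s l) (s≤s r) = EdgeOfPath-map ℕ-path ℕ-path suc (⋯-edge a b l r)

∣1+m-n∣<∣m-n∣ : ∀ {m n} → m < n → ∣ suc m - n ∣ < ∣ m - n ∣
∣1+m-n∣<∣m-n∣ {zero}  {suc n} _         = n<1+n n
∣1+m-n∣<∣m-n∣ {suc m} {suc n} (s≤s m<n) = ∣1+m-n∣<∣m-n∣ m<n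

∣m-n∣<∣1+m-n∣ : ∀ {m n} → n ≤ m → ∣ m - n ∣ < ∣ suc m - n ∣
∣m-n∣<∣1+m-n∣ {m}     {zero}  _         = subst (_< suc m) (sym (∣-∣-identityʳ m)) (n<1+n m)
∣m-n∣<∣1+m-n∣ {suc m} {suc n} (s≤s n≤m) = ∣m-n∣<∣1+m-n∣ n≤m

record Ranking (G : Graph) : Set where
  field
    rank   : V G → ℕ
    parent : V G → V G
    root   : V G

  ParentEdge : V G → V G → Set
  ParentEdge u v = v ≡ parent u × rank v < rank u

  field
    rank-zero      : ∀ {u} → rank u ≡ 0 → u ≡ root
    descend        : ∀ {u} → 0 < rank u → E G u (parent u) × rank (parent u) < rank u
    edge-to-parent : ∀ {u v} → E G u v → ParentEdge u v ⊎ ParentEdge v u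

  adjacent-ranks : ∀ {u v} → E G u v → rank u < rank v ⊎ rank v < rank u
  adjacent-ranks = Sum.swap ∘ Sum.map proj₂ proj₂ ∘ edge-to-parent

module _ {G : Graph} (ρ : Ranking G) where
  open Ranking ρ

  private
    secondLast : V G → V G → List (V G) → V G
    secondLast a b []      = a
    secondLast a b (c ∷ r) = secondLast b c r

    last-edge : ∀ a b r → Linked (E G) (a ∷ b ∷ r) → E G (secondLast a b r) (lastFrom G b r)
    last-edge a b []      (e ∷ _) = e
    last-edge a b (c ∷ r) (_ ∷ l) = last-edge b c r l

    secondLast-∈ : ∀ a b r → secondLast a b r ∈ a ∷ b ∷ r
    secondLast-∈ a b []      = here refl
    secondLast-∈ a b (c ∷ r) = there (secondLast-∈ b c r)

    lastFrom-∈ : ∀ a r → lastFrom G a r ∈ a ∷ r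
    lastFrom-∈ a []      = here refl
    lastFrom-∈ a (b ∷ r) = there (lastFrom-∈ b r)

    head-∉ : ∀ {x y : V G} {xs} → Unique (x ∷ xs) → y ∈ xs → x ≢ y
    head-∉ (x∉ ∷ _) y∈ = All.lookup x∉ y∈

  lower-neighbours-equal : ∀ {a b c} → E G a b → E G b c → rank a < rank b → rank c < rank b → a ≡ c
  lower-neighbours-equal ab bc a<b c<b with edge-to-parent ab | edge-to-parent bc
  ... | inj₁ (_ , b<a) | _              = ⊥-elim (<-asym a<b b<a)
  ... | _              | inj₂ (_ , b<c) = ⊥-elim (<-asym c<b b<c)
  ... | inj₂ (a≡ , _)  | inj₁ (c≡ , _)  = trans a≡ (sym c≡)

  -- A vertex has only one lower neighbour, so along a path the rank first falls, then rises.
  ascent-persists : ∀ a b r → Linked (E G) (a ∷ b ∷ r) → Unique (a ∷ b ∷ r) → rank a < rank b →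
                    rank (secondLast a b r) < rank (lastFrom G b r) × rank a < rank (lastFrom G b r)
  ascent-persists a b []      _           _                  a<b = a<b , a<b
  ascent-persists a b (c ∷ r) (ab ∷ rest@(bc ∷ _)) u@(_ ∷ u′) a<b with adjacent-ranks bc
  ... | inj₂ c<b = ⊥-elim (head-∉ u (there (here refl)) (lower-neighbours-equal ab bc a<b c<b))
  ... | inj₁ b<c with y<z , b<z ← ascent-persists b c r rest u′ b<c = y<z , <-trans a<b b<z

  descent-before : ∀ a b r → Linked (E G) (a ∷ b ∷ r) → Unique (a ∷ b ∷ r) →
                   rank (lastFrom G b r) < rank (secondLast a b r) →
                   rank b < rank a × rank (lastFrom G b r) < rank a
  descent-before a b []      _                    _          b<a = b<a , b<a
  descent-before a b (c ∷ r) (ab ∷ rest@(bc ∷ _)) u@(_ ∷ u′) z<y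
    with c<b , z<b ← descent-before b c r rest u′ z<y | adjacent-ranks ab
  ... | inj₁ a<b = ⊥-elim (head-∉ u (there (here refl)) (lower-neighbours-equal ab bc a<b c<b))
  ... | inj₂ b<a = b<a , <-trans z<b b<a

  Ranking⇒Acyclic : Acyclic G
  Ranking⇒Acyclic x []          (() , _)
  Ranking⇒Acyclic x (b ∷ [])    (s≤s () , _)
  Ranking⇒Acyclic x (b ∷ c ∷ r) (_ , (linked@(xb ∷ _) , u@(_ ∷ u′)) , zx)
    with adjacent-ranks (last-edge x b (c ∷ r) linked)
  ... | inj₂ z<y with b<x , z<x ← descent-before x b (c ∷ r) linked u z<y =
    head-∉ u′ (lastFrom-∈ c r) (sym (lower-neighbours-equal zx xb z<x b<x))
  ... | inj₁ y<z with adjacent-ranks zx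
  ...   | inj₂ x<z =
    head-∉ u (secondLast-∈ b c r) (sym (lower-neighbours-equal (last-edge x b (c ∷ r) linked) zx y<z x<z))
  ...   | inj₁ z<x with adjacent-ranks xb
  ...     | inj₁ x<b = <-asym z<x (proj₂ (ascent-persists x b (c ∷ r) linked u x<b))
  ...     | inj₂ b<x = head-∉ u′ (lastFrom-∈ c r) (sym (lower-neighbours-equal zx xb z<x b<x))

  path-to-root : ∀ k {u} → rank u ≤ k → Star (E G) u root
  path-to-root zero    {u} r≤0 = subst (Star (E G) u) (rank-zero (n≤0⇒n≡0 r≤0)) ε
  path-to-root (suc k) {u} r≤k with rank u ≟ 0
  ... | yes r≡0 = subst (Star (E G) u) (rank-zero r≡0) ε
  ... | no  r≢0 with up , lower ← descend (n≢0⇒n>0 r≢0) = up ◅ path-to-root k (s≤s⁻¹ (≤-trans lower r≤k))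

  Ranking⇒Connected : Symmetric (E G) → Connected G
  Ranking⇒Connected E-sym u v = Star⇒walk G (path-to-root _ ≤-refl ◅◅ Star.reverse E-sym (path-to-root _ ≤-refl))

  Ranking⇒IsTree : Symmetric (E G) → IsTree G
  Ranking⇒IsTree E-sym = Ranking⇒Connected E-sym , Ranking⇒Acyclic

module LegSpineLists (G : Graph) (spine : List (V G)) (leg₁ leg₂ : V G → List (V G)) where

  legs : V G → List (V G)
  legs v = leg₁ v ++ leg₂ v

  vertices : List (V G)
  vertices = spine ++ concat (map legs spine)

  LegEdge : V G → V G → V G → Set
  LegEdge w u v = EdgeOfPath G (w ∷ leg₁ w) u v ⊎ EdgeOfPath G (w ∷ leg₂ w) u v

  Covers : V G → V G → Set
  Covers u v = EdgeOfPath G spine u v ⊎ Σ (V G) λ w → w ∈ spine × LegEdge w u v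

  Covers-sym : ∀ {u v} → Covers u v → Covers v u
  Covers-sym = Sum.map (EdgeOfPath-sym G) (Product.map₂ (Product.map₂ (Sum.map (EdgeOfPath-sym G) (EdgeOfPath-sym G))))

  spine⊆vertices : ∀ {v} → v ∈ spine → v ∈ vertices
  spine⊆vertices = ∈-++⁺ˡ

  leg₁⊆vertices : ∀ {v w} → v ∈ spine → w ∈ v ∷ leg₁ v → w ∈ vertices
  leg₁⊆vertices v∈ (here refl) = spine⊆vertices v∈
  leg₁⊆vertices v∈ (there w∈)  = ∈-++⁺ʳ spine (∈-concat⁺′ (∈-++⁺ˡ w∈) (∈-map⁺ legs v∈))

  leg₂⊆vertices : ∀ {v w} → v ∈ spine → w ∈ v ∷ leg₂ v → w ∈ vertices
  leg₂⊆vertices v∈     (here refl) = spine⊆vertices v∈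
  leg₂⊆vertices {v} v∈ (there w∈)  =
    ∈-++⁺ʳ spine (∈-concat⁺′ (∈-++⁺ʳ (leg₁ v) w∈) (∈-map⁺ legs v∈))

-- Completeness is only required inside Inside, so that a finite part of an infinite graph
-- can be decomposed.
record LegSpine (G : Graph) (Inside : V G → Set) : Set where
  field
    spine     : List (V G)
    leg₁ leg₂ : V G → List (V G)

  open LegSpineLists G spine leg₁ leg₂ public

  field
    spine-nonempty    : 1 ≤ length spine
    spine-path        : IsPath G spine
    legs-path         : ∀ {v} → v ∈ spine → IsPath G (v ∷ leg₁ v) × IsPath G (v ∷ leg₂ v)
    vertices-unique   : Unique vertices
    vertices-complete : ∀ {v} → Inside v → v ∈ vertices
    edges-complete    : ∀ {u v} → Inside u → Inside v → E G u v → Covers u v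

LegSpine⇒SpineDecomposition : ∀ {G} → LegSpine G (λ _ → ⊤) → SpineDecomposition G
LegSpine⇒SpineDecomposition {G} L =
  spine , legsAt , spine-nonempty , spine-path , (λ i → legs-path (∈-lookup i)) ,
  subst Unique vertices≡ vertices-unique , (λ v → subst (v ∈_) vertices≡ (vertices-complete tt)) ,
  λ u v e → Sum.map₂ indexed (edges-complete tt tt e)
  where
  open LegSpine L
  legsAt : Fin (length spine) → List (V G) × List (V G)
  legsAt i = leg₁ (lookup spine i) , leg₂ (lookup spine i)

  vertices≡ : vertices ≡ spine ++ concat (tabulate (λ i → legs (lookup spine i)))
  vertices≡ = cong (λ t → spine ++ concat t)
    (trans (cong (map legs) (sym (tabulate-lookup spine))) (map-tabulate (lookup spine) legs))

  indexed : ∀ {u v} → (Σ (V G) λ w → w ∈ spine × LegEdge w u v) → Σ (Fin (length spine)) λ i → LegEdge (lookup spine i) u v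
  indexed {u} {v} (w , w∈ , on-leg) = Any.index w∈ , subst (λ x → LegEdge x u v) (lookup-index w∈) on-leg

record Embedding (G H : Graph) : Set where
  field
    to      : V G → V H
    from    : V H → V G
    from-to : ∀ v → from (to v) ≡ v
    to-E    : ∀ {u v} → E G u v → E H (to u) (to v)
    from-E  : ∀ {u v} → E H (to u) (to v) → E G u v

  InRange : V H → Set
  InRange p = to (from p) ≡ p

  to-injective : ∀ {u v} → to u ≡ to v → u ≡ v
  to-injective {u} {v} eq = trans (sym (from-to u)) (trans (cong from eq) (from-to v))

module _ {G H : Graph} (emb : Embedding G H) where
  open Embedding emb

  private
    map-to-from : ∀ {xs} → All InRange xs → map to (map from xs) ≡ xs
    map-to-from {xs} in-range = trans (sym (map-∘ xs)) (map-id-local in-range)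

  map-from-unique : ∀ {xs} → All InRange xs → Unique xs → Unique (map from xs)
  map-from-unique in-range unique = Unique.map⁻ (subst Unique (sym (map-to-from in-range)) unique)

  map-from-path : ∀ {xs} → All InRange xs → IsPath H xs → IsPath G (map from xs)
  map-from-path in-range (linked , unique) =
    Linked.map from-E (Linked.map⁻ (subst (Linked (E H)) (sym (map-to-from in-range)) linked)) ,
    map-from-unique in-range unique

  map-from-edge : ∀ {xs u v} → EdgeOfPath H xs (to u) (to v) → EdgeOfPath G (map from xs) u v
  map-from-edge {xs} {u} {v} e =
    subst₂ (EdgeOfPath G (map from xs)) (from-to u) (from-to v) (EdgeOfPath-map H G from e)

  map-from-∈ : ∀ {xs v} → to v ∈ xs → v ∈ map from xs
  map-from-∈ {v = v} p = subst (_∈ _) (from-to v) (∈-map⁺ from p)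

  Ranking-pullback : (ρ : Ranking H) → let open Ranking ρ in
                     (∀ {u} → 0 < rank (to u) → InRange (parent (to u))) → Ranking G
  Ranking-pullback ρ parent-in-range = record
    { rank            = rank ∘ to
    ; parent          = from ∘ parent ∘ to
    ; root            = from root
    ; rank-zero       = λ {u} r≡0 → trans (sym (from-to u)) (cong from (rank-zero r≡0))
    ; descend         = descend′
    ; edge-to-parent  = Sum.map pull pull ∘ edge-to-parent ∘ to-E
    }
    where
    open Ranking ρ
    pull : ∀ {u v} → ParentEdge (to u) (to v) → v ≡ from (parent (to u)) × rank (to v) < rank (to u)
    pull {v = v} (v≡ , lower) = trans (sym (from-to v)) (cong from v≡) , lower

    descend′ : ∀ {u} → 0 < rank (to u) → E G u (from (parent (to u))) × rank (to (from (parent (to u)))) < rank (to u)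
    descend′ {u} pos with e , lower ← descend pos =
      from-E (subst (E H (to u)) (sym r) e) , subst (λ p → rank p < rank (to u)) (sym r) lower
      where
      r : InRange (parent (to u))
      r = parent-in-range pos

  LegSpine-pullback : ∀ {Inside} (L : LegSpine H Inside) → (∀ v → Inside (to v)) →
                      (∀ {p} → p ∈ LegSpine.vertices L → InRange p) → LegSpine G (λ _ → ⊤)
  LegSpine-pullback L inside in-range = record
    { spine             = map from spine
    ; leg₁              = leg₁′
    ; leg₂              = leg₂′
    ; spine-nonempty    = subst (1 ≤_) (sym (length-map from spine)) spine-nonempty
    ; spine-path        = map-from-path (All.tabulate (in-range ∘ spine⊆vertices)) spine-path
    ; legs-path         = legs-path′
    ; vertices-unique   = subst Unique (sym vertices≡) (map-from-unique (All.tabulate in-range) vertices-unique)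
    ; vertices-complete = λ {v} _ → subst (v ∈_) (sym vertices≡) (map-from-∈ (vertices-complete (inside v)))
    ; edges-complete    = λ {u} {v} _ _ e → covers (edges-complete (inside u) (inside v) (to-E e))
    }
    where
    open LegSpine L
    leg₁′ leg₂′ : V G → List (V G)
    leg₁′ v = map from (leg₁ (to v))
    leg₂′ v = map from (leg₂ (to v))
    module Pulled = LegSpineLists G (map from spine) leg₁′ leg₂′

    legs-from : ∀ {p} → p ∈ vertices → map from (legs (to (from p))) ≡ map from (legs p)
    legs-from p∈ = cong (map from ∘ legs) (in-range p∈)

    vertices≡ : Pulled.vertices ≡ map from vertices
    vertices≡ = begin
      map from spine ++ concat (map Pulled.legs (map from spine))
        ≡⟨ cong (λ t → map from spine ++ concat t) legs≡ ⟩
      map from spine ++ concat (map (map from) (map legs spine))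
        ≡⟨ cong (map from spine ++_) (concat-map (map legs spine)) ⟩
      map from spine ++ map from (concat (map legs spine))
        ≡⟨ map-++ from spine _ ⟨
      map from vertices ∎
      where
      open ≡-Reasoning
      legs≡ : map Pulled.legs (map from spine) ≡ map (map from) (map legs spine)
      legs≡ = trans (sym (map-∘ spine))
                (trans (map-cong-local (All.tabulate λ {p} p∈ →
                          trans (sym (map-++ from (leg₁ (to (from p))) _)) (legs-from (spine⊆vertices p∈))))
                       (map-∘ spine))

    legs-path′ : ∀ {v} → v ∈ map from spine → IsPath G (v ∷ leg₁′ v) × IsPath G (v ∷ leg₂′ v)
    legs-path′ v∈ with p , p∈ , refl ← ∈-map⁻ from v∈ rewrite in-range (spine⊆vertices p∈) =
      map-from-path (All.tabulate (in-range ∘ leg₁⊆vertices p∈)) (proj₁ (legs-path p∈)) ,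
      map-from-path (All.tabulate (in-range ∘ leg₂⊆vertices p∈)) (proj₂ (legs-path p∈))

    covers : ∀ {u v} → Covers (to u) (to v) → Pulled.Covers u v
    covers (inj₁ on-spine) = inj₁ (map-from-edge on-spine)
    covers {u} {v} (inj₂ (p , p∈ , on-leg)) =
      inj₂ (from p , ∈-map⁺ from p∈ ,
            subst (λ q → EdgeOfPath G (from p ∷ map from (leg₁ q)) u v
                       ⊎ EdgeOfPath G (from p ∷ map from (leg₂ q)) u v)
                  (sym (in-range (spine⊆vertices p∈))) (Sum.map map-from-edge map-from-edge on-leg))

Sierpinski-embedding : ∀ {G G′ H H′} (eG : Embedding G G′) (eH : Embedding H H′) f f′ →
                       (∀ g → Embedding.to eH (f g) ≡ f′ (Embedding.to eG g)) →
                       Embedding (Sierpinski G H f) (Sierpinski G′ H′ f′)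
Sierpinski-embedding {G} {G′} {H} {H′} eG eH f f′ to-f = record
  { to      = Product.map (to eG) (to eH)
  ; from    = Product.map (from eG) (from eH)
  ; from-to = λ (g , h) → cong₂ _,_ (from-to eG g) (from-to eH h)
  ; to-E    = to-E′
  ; from-E  = from-E′
  }
  where
  open Embedding
  to-E′ : ∀ {u v} → E (Sierpinski G H f) u v → E (Sierpinski G′ H′ f′) _ _
  to-E′ (inj₁ (refl , e))         = inj₁ (refl , to-E eH e)
  to-E′ (inj₂ (e , refl , refl)) = inj₂ (to-E eG e , to-f _ , to-f _)
  from-E′ : ∀ {u v} → E (Sierpinski G′ H′ f′) (Product.map (to eG) (to eH) u) (Product.map (to eG) (to eH) v) →
            E (Sierpinski G H f) u v
  from-E′ (inj₁ (g≡ , e))          = inj₁ (to-injective eG g≡ , from-E eH e)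
  from-E′ (inj₂ (e , h≡ , h′≡)) =
    inj₂ (from-E eG e , to-injective eH (trans h≡ (sym (to-f _))) , to-injective eH (trans h′≡ (sym (to-f _))))

Sierpinski-sym : ∀ {G H} f → Symmetric (E G) → Symmetric (E H) → Symmetric (E (Sierpinski G H f))
Sierpinski-sym f G-sym H-sym (inj₁ (refl , e))   = inj₁ (refl , H-sym e)
Sierpinski-sym f G-sym H-sym (inj₂ (e , h , h′)) = inj₂ (G-sym e , h′ , h)

P-sym : ∀ k → Symmetric (E (P k))
P-sym k = Sum.swap

-- Junk value 0 outside the range.
toFin : ∀ {k} → ℕ → Fin (suc k)
toFin {k} a with a <? suc k
... | yes a<k = fromℕ< a<k
... | no  _   = Data.Fin.zero

toℕ-toFin : ∀ {k a} → a < suc k → toℕ (toFin {k} a) ≡ a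
toℕ-toFin {k} {a} a<k with a <? suc k
... | yes a<k′ = toℕ-fromℕ< a<k′
... | no  a≮k  = ⊥-elim (a≮k a<k)

toFin-toℕ : ∀ {k} (i : Fin (suc k)) → toFin (toℕ i) ≡ i
toFin-toℕ {k} i with toℕ i <? suc k
... | yes i<k = fromℕ<-toℕ i i<k
... | no  i≮k = ⊥-elim (i≮k (toℕ<n i))

P-embedding : ∀ k → Embedding (P (suc k)) ℕ-path
P-embedding k = record { to = toℕ ; from = toFin ; from-to = toFin-toℕ ; to-E = λ e → e ; from-E = λ e → e }

module Model (m top : ℕ) (F : ℕ → ℕ) (F≤top : ∀ g → F g ≤ top) where

  H : Graph
  H = Sierpinski ℕ-path ℕ-path F

  Inside : V H → Set
  Inside (g , h) = g < m × h ≤ top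

  -- Copies 0 and m − 1 have only one neighbouring copy; their other port, F (pred 0) resp.
  -- F m, is an arbitrary height, which is harmless.
  entry exit : ℕ → ℕ
  entry g = F (pred g)
  exit  g = F (suc g)

  data Step : V H → V H → Set where
    vertical : ∀ g h → Step (g , h) (g , suc h)
    crossing : ∀ g → Step (g , exit g) (suc g , entry (suc g))

  step-view : ∀ {p q} → E H p q → Step p q ⊎ Step q p
  step-view (inj₁ (refl , inj₁ refl))         = inj₁ (vertical _ _)
  step-view (inj₁ (refl , inj₂ refl))         = inj₂ (vertical _ _)
  step-view (inj₂ (inj₁ refl , refl , refl)) = inj₁ (crossing _)
  step-view (inj₂ (inj₂ refl , refl , refl)) = inj₂ (crossing _)

  -- rank p is the distance from root to p in the tree; depth g is the rank of (g , entry g).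
  depth : ℕ → ℕ
  depth zero    = 0
  depth (suc g) = suc (depth g + ∣ exit g - entry g ∣)

  rank : V H → ℕ
  rank (g , h) = depth g + ∣ h - entry g ∣

  parent : V H → V H
  parent (g , h) with <-cmp h (entry g)
  ... | tri< _ _ _ = g , suc h
  ... | tri≈ _ _ _ = pred g , F g
  ... | tri> _ _ _ = g , pred h

  root : V H
  root = 0 , entry 0

  rank-below : ∀ {g h} → h < entry g → rank (g , suc h) < rank (g , h)
  rank-below {g} h<e = +-monoʳ-< (depth g) (∣1+m-n∣<∣m-n∣ h<e)

  rank-above : ∀ {g h} → entry g ≤ h → rank (g , h) < rank (g , suc h)
  rank-above {g} e≤h = +-monoʳ-< (depth g) (∣m-n∣<∣1+m-n∣ e≤h)

  rank-crossing : ∀ g → rank (g , exit g) < rank (suc g , entry (suc g))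
  rank-crossing g = m≤m+n (suc (rank (g , exit g))) _

  parent-below : ∀ {g h} → h < entry g → parent (g , h) ≡ (g , suc h)
  parent-below {g} {h} h<e with <-cmp h (entry g)
  ... | tri< _ _ _   = refl
  ... | tri≈ h≮e _ _ = ⊥-elim (h≮e h<e)
  ... | tri> h≮e _ _ = ⊥-elim (h≮e h<e)

  parent-above : ∀ {g h} → entry g < suc h → parent (g , suc h) ≡ (g , h)
  parent-above {g} {h} e<h with <-cmp (suc h) (entry g)
  ... | tri< _ _ e≯h = ⊥-elim (e≯h e<h)
  ... | tri≈ _ _ e≯h = ⊥-elim (e≯h e<h)
  ... | tri> _ _ _   = refl

  parent-entry : ∀ g → parent (suc g , entry (suc g)) ≡ (g , exit g)
  parent-entry g with <-cmp (F g) (F g)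
  ... | tri< _ ≢ _ = ⊥-elim (≢ refl)
  ... | tri≈ _ _ _ = refl
  ... | tri> _ ≢ _ = ⊥-elim (≢ refl)

  ranking : Ranking H
  ranking = record
    { rank           = rank
    ; parent         = parent
    ; root           = root
    ; rank-zero      = rank-zero
    ; descend        = descend
    ; edge-to-parent = Sum.[ step-to-parent , Sum.swap ∘ step-to-parent ] ∘ step-view
    }
    where
    rank-zero : ∀ {p} → rank p ≡ 0 → p ≡ root
    rank-zero {zero , h} r≡0 = cong (0 ,_) (∣m-n∣≡0⇒m≡n r≡0)

    step-to-parent : ∀ {p q} → Step p q → (q ≡ parent p × rank q < rank p) ⊎ (p ≡ parent q × rank p < rank q)
    step-to-parent (vertical g h) with h <? entry g
    ... | yes h<e = inj₁ (sym (parent-below h<e) , rank-below h<e)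
    ... | no  h≮e = inj₂ (sym (parent-above (s≤s (≮⇒≥ h≮e))) , rank-above (≮⇒≥ h≮e))
    step-to-parent (crossing g) = inj₂ (sym (parent-entry g) , rank-crossing g)

    descend : ∀ {p} → 0 < rank p → E H p (parent p) × rank (parent p) < rank p
    descend {g , h} pos with <-cmp h (entry g)
    descend {g , h}      pos | tri< h<e _ _ = inj₁ (refl , inj₁ refl) , rank-below h<e
    descend {g , suc h}  pos | tri> _ _ e<h = inj₁ (refl , inj₂ refl) , rank-above (s≤s⁻¹ e<h)
    descend {zero , _}   pos | tri≈ _ refl _ = ⊥-elim (<-irrefl (sym (∣n-n∣≡0 (entry 0))) pos)
    descend {suc g , _}  pos | tri≈ _ refl _ = inj₂ (inj₂ refl , refl , refl) , rank-crossing g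

  parent-inside : ∀ {p} → Inside p → Inside (parent p)
  parent-inside {g , h} (g<m , h≤top) with <-cmp h (entry g)
  ... | tri< h<e _ _ = g<m , ≤-trans h<e (F≤top _)
  ... | tri≈ _ _ _   = ≤-<-trans pred[n]≤n g<m , F≤top g
  ... | tri> _ _ _   = g<m , ≤-trans pred[n]≤n h≤top

  column : ℕ → ℕ → ℕ → List (V H)
  column g a b = map (g ,_) (a ⋯ b)

  column-path : ∀ g a b → IsPath H (column g a b)
  column-path g a b = Linked.map⁺ (Linked.map (λ e → inj₁ (refl , e)) (⋯-linked a b)) ,
                      Unique.map⁺ (cong proj₂) (⋯-unique a b)

  ∈-column⁻ : ∀ {g a b j z} → (j , z) ∈ column g a b → j ≡ g × a ⊓ b ≤ z × z ≤ a ⊔ b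
  ∈-column⁻ {g} {a} {b} p with z , z∈ , refl ← ∈-map⁻ (g ,_) p = refl , ∈-⋯⁻ a b z∈

  lastFrom-column : ∀ g a b → lastFrom H (g , a) (map (g ,_) (towards a b)) ≡ (g , b)
  lastFrom-column g a b = trans (lastFrom-map ℕ-path H (g ,_) a (towards a b)) (cong (g ,_) (lastFrom-⋯ a b))

  column-edge : ∀ g a b {z} → a ⊓ b ≤ z → suc z ≤ a ⊔ b → EdgeOfPath H (column g a b) (g , z) (g , suc z)
  column-edge g a b l r = EdgeOfPath-map ℕ-path H (g ,_) (⋯-edge a b l r)

  low high : ℕ → ℕ
  low  g = exit g ⊓ entry g
  high g = exit g ⊔ entry g

  high≤top : ∀ g → high g ≤ top
  high≤top g = ⊔-lub (F≤top _) (F≤top _)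

  segment : ℕ → List (V H)
  segment g = column g (exit g) (entry g)

  spineUpTo : ℕ → List (V H)
  spineUpTo zero    = []
  spineUpTo (suc g) = segment g ++ spineUpTo g

  spineUpTo-linked : ∀ k → Linked (E H) (spineUpTo k)
  spineUpTo-linked zero          = []
  spineUpTo-linked (suc zero)    = subst (Linked (E H)) (sym (++-identityʳ (segment 0))) (proj₁ (column-path 0 _ _))
  spineUpTo-linked (suc (suc g)) =
    Linked-++ H (proj₁ (column-path (suc g) _ _)) cross (spineUpTo-linked (suc g))
    where
    cross : E H (lastFrom H (suc g , exit (suc g)) (map (suc g ,_) (towards (exit (suc g)) (entry (suc g))))) (g , exit g)
    cross = subst (λ x → E H x (g , exit g)) (sym (lastFrom-column (suc g) (exit (suc g)) (entry (suc g))))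
                  (inj₂ (inj₂ refl , refl , refl))

  ∈-spineUpTo⁻ : ∀ {k j z} → (j , z) ∈ spineUpTo k → j < k × low j ≤ z × z ≤ high j
  ∈-spineUpTo⁻ {suc k} p with ∈-++⁻ (segment k) p
  ... | inj₁ q with refl , range ← ∈-column⁻ q = ≤-refl , range
  ... | inj₂ q with j<k , range ← ∈-spineUpTo⁻ q = m<n⇒m<1+n j<k , range

  spineUpTo-unique : ∀ k → Unique (spineUpTo k)
  spineUpTo-unique zero    = []
  spineUpTo-unique (suc k) = Unique.++⁺ (proj₂ (column-path k _ _)) (spineUpTo-unique k) disjoint
    where
    disjoint : ∀ {p} → ¬ (p ∈ segment k × p ∈ spineUpTo k)
    disjoint {j , z} (p , q) with refl ← proj₁ (∈-column⁻ p) = <-irrefl refl (proj₁ (∈-spineUpTo⁻ q))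

  spineUpTo-suffix : ∀ {k k′} → k ≤ k′ → Σ (List (V H)) λ xs → spineUpTo k′ ≡ xs ++ spineUpTo k
  spineUpTo-suffix {k′ = zero}  z≤n = [] , refl
  spineUpTo-suffix {k} {suc k′} k≤ with m≤n⇒m<n∨m≡n k≤
  ... | inj₂ refl = [] , refl
  ... | inj₁ (s≤s k≤k′) with xs , eq ← spineUpTo-suffix k≤k′ =
    segment k′ ++ xs , trans (cong (segment k′ ++_) eq) (sym (++-assoc (segment k′) xs _))

  segment⊆spineUpTo : ∀ {j k p} → j < k → p ∈ segment j → p ∈ spineUpTo k
  segment⊆spineUpTo {j} j<k p with xs , eq ← spineUpTo-suffix j<k =
    subst (_ ∈_) (sym eq) (∈-++⁺ʳ xs (∈-++⁺ˡ p))

  segment-edge⇒spineUpTo-edge : ∀ {j k u v} → j < k → EdgeOfPath H (segment j) u v → EdgeOfPath H (spineUpTo k) u v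
  segment-edge⇒spineUpTo-edge {j} j<k e with xs , eq ← spineUpTo-suffix j<k =
    subst (λ ys → EdgeOfPath H ys _ _) (sym eq) (EdgeOfPath-++ˡ H xs (EdgeOfPath-++ʳ H (spineUpTo j) e))

  crossing-edge : ∀ {j k} → suc j < k → EdgeOfPath H (spineUpTo k) (j , exit j) (suc j , entry (suc j))
  crossing-edge {j} 1+j<k with xs , eq ← spineUpTo-suffix 1+j<k =
    subst (λ ys → EdgeOfPath H ys _ _) (sym eq) (EdgeOfPath-++ˡ H xs (inj₂ consec))
    where
    consec : Consec H (spineUpTo (suc (suc j))) (suc j , entry (suc j)) (j , exit j)
    consec = subst (λ x → Consec H (spineUpTo (suc (suc j))) x (j , exit j))
                   (lastFrom-column (suc j) (exit (suc j)) (entry (suc j))) (Consec-last H (suc j , exit (suc j)) _)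

  spine : List (V H)
  spine = spineUpTo m

  ∈-spine⁻ : ∀ {j z} → (j , z) ∈ spine → j < m × low j ≤ z × z ≤ high j
  ∈-spine⁻ = ∈-spineUpTo⁻ {m}

  leg₁ leg₂ : V H → List (V H)
  leg₁ (g , h) with h ≟ low g
  ... | yes _ = map (g ,_) (towards h 0)
  ... | no  _ = []
  leg₂ (g , h) with h ≟ high g
  ... | yes _ = map (g ,_) (towards h top)
  ... | no  _ = []

  open LegSpineLists H spine leg₁ leg₂

  leg₁-low : ∀ g → leg₁ (g , low g) ≡ map (g ,_) (towards (low g) 0)
  leg₁-low g with low g ≟ low g
  ... | yes _  = refl
  ... | no  ≢ = ⊥-elim (≢ refl)

  leg₂-high : ∀ g → leg₂ (g , high g) ≡ map (g ,_) (towards (high g) top)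
  leg₂-high g with high g ≟ high g
  ... | yes _  = refl
  ... | no  ≢ = ⊥-elim (≢ refl)

  leg₁-path : ∀ p → IsPath H (p ∷ leg₁ p)
  leg₁-path (g , h) with h ≟ low g
  ... | yes _ = column-path g h 0
  ... | no  _ = [-] , [] ∷ []

  leg₂-path : ∀ p → IsPath H (p ∷ leg₂ p)
  leg₂-path (g , h) with h ≟ high g
  ... | yes _ = column-path g h top
  ... | no  _ = [-] , [] ∷ []

  ∈-leg₁⁻ : ∀ {p j z} → (j , z) ∈ leg₁ p → p ≡ (j , low j) × z < low j
  ∈-leg₁⁻ {g , h} p with h ≟ low g
  ... | yes refl with z , z∈ , refl ← ∈-map⁻ (g ,_) p with (_ , z≤) , z≢ ← ∈-towards⁻ (low g) 0 z∈ =
    refl , ≤∧≢⇒< (subst (z ≤_) (⊔-identityʳ _) z≤) z≢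

  ∈-leg₂⁻ : ∀ {p j z} → (j , z) ∈ leg₂ p → p ≡ (j , high j) × high j < z × z ≤ top
  ∈-leg₂⁻ {g , h} p with h ≟ high g
  ... | yes refl with z , z∈ , refl ← ∈-map⁻ (g ,_) p with (≤z , z≤) , z≢ ← ∈-towards⁻ (high g) top z∈ =
    refl , ≤∧≢⇒< (subst (_≤ z) (m≤n⇒m⊓n≡m (high≤top g)) ≤z) (z≢ ∘ sym) ,
    subst (z ≤_) (m≤n⇒m⊔n≡n (high≤top g)) z≤

  ∈-legs⁻ : ∀ {p j z} → (j , z) ∈ legs p →
            (p ≡ (j , low j) × z < low j) ⊎ (p ≡ (j , high j) × high j < z × z ≤ top)
  ∈-legs⁻ {p} q = Sum.map (∈-leg₁⁻ {p}) (∈-leg₂⁻ {p}) (∈-++⁻ (leg₁ p) q)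

  legs-apart : ∀ {j z} → z < low j → high j < z → ⊥
  legs-apart {j} z<low high<z = <-asym z<low (≤-<-trans (m⊓n≤m⊔n (exit j) (entry j)) high<z)

  legs-unique : ∀ p → Unique (legs p)
  legs-unique p with _ ∷ u₁ ← proj₂ (leg₁-path p) | _ ∷ u₂ ← proj₂ (leg₂-path p) =
    Unique.++⁺ u₁ u₂ apart
    where
    apart : ∀ {v} → ¬ (v ∈ leg₁ p × v ∈ leg₂ p)
    apart {j , z} (q₁ , q₂) = legs-apart (proj₂ (∈-leg₁⁻ {p} q₁)) (proj₁ (proj₂ (∈-leg₂⁻ {p} q₂)))

  legs-overlap : ∀ {p q v} → v ∈ legs p → v ∈ legs q → p ≡ q
  legs-overlap {p} {q} {j , z} a b with ∈-legs⁻ {p} a | ∈-legs⁻ {q} b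
  ... | inj₁ (p≡ , _)       | inj₁ (q≡ , _)      = trans p≡ (sym q≡)
  ... | inj₂ (p≡ , _)       | inj₂ (q≡ , _)      = trans p≡ (sym q≡)
  ... | inj₁ (_ , z<low)    | inj₂ (_ , high<z , _) = ⊥-elim (legs-apart z<low high<z)
  ... | inj₂ (_ , high<z , _) | inj₁ (_ , z<low)  = ⊥-elim (legs-apart z<low high<z)

  ∈-attached⁻ : ∀ {v} → v ∈ concat (map legs spine) → Σ (V H) λ p → p ∈ spine × v ∈ legs p
  ∈-attached⁻ v∈ with xs , v∈xs , xs∈ ← ∈-concat⁻′ (map legs spine) v∈
                   with p , p∈ , refl ← ∈-map⁻ legs xs∈ = p , p∈ , v∈xs

  vertices-unique : Unique vertices
  vertices-unique = Unique.++⁺ (spineUpTo-unique m) attached-unique apart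
    where
    attached-unique : Unique (concat (map legs spine))
    attached-unique = Unique.concat⁺ (AllProp.map⁺ (All.tabulate (λ {p} _ → legs-unique p)))
      (AllPairsProp.map⁺ (AllPairs.map (λ p≢q {_} (a , b) → p≢q (legs-overlap a b)) (spineUpTo-unique m)))
    apart : ∀ {v} → ¬ (v ∈ spine × v ∈ concat (map legs spine))
    apart {j , z} (v∈ , v∈′) with ∈-spine⁻ v∈ | ∈-attached⁻ v∈′
    ... | _ , low≤z , z≤high | p , _ , v∈legs with ∈-legs⁻ {p} v∈legs
    ...   | inj₁ (_ , z<low)      = <⇒≱ z<low low≤z
    ...   | inj₂ (_ , high<z , _) = <⇒≱ high<z z≤high

  vertices-inside : ∀ {v} → v ∈ vertices → Inside v
  vertices-inside {j , z} v∈ with ∈-++⁻ spine v∈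
  ... | inj₁ v∈spine with j<m , _ , z≤high ← ∈-spine⁻ v∈spine = j<m , ≤-trans z≤high (high≤top j)
  ... | inj₂ v∈legs with p , p∈ , v∈p ← ∈-attached⁻ v∈legs with ∈-legs⁻ {p} v∈p
  ...   | inj₁ (p≡ , z<low)     = proj₁ (∈-spine⁻ (subst (_∈ spine) p≡ p∈)) ,
                                  ≤-trans (<⇒≤ z<low) (≤-trans (m⊓n≤m⊔n _ _) (high≤top j))
  ...   | inj₂ (p≡ , _ , z≤top) = proj₁ (∈-spine⁻ (subst (_∈ spine) p≡ p∈)) , z≤top

  low∈spine : ∀ {g} → g < m → (g , low g) ∈ spine
  low∈spine g<m = segment⊆spineUpTo g<m (∈-map⁺ _ (∈-⋯⁺ _ _ ≤-refl (m⊓n≤m⊔n _ _)))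

  high∈spine : ∀ {g} → g < m → (g , high g) ∈ spine
  high∈spine g<m = segment⊆spineUpTo g<m (∈-map⁺ _ (∈-⋯⁺ _ _ (m⊓n≤m⊔n _ _) ≤-refl))

  vertices-complete : ∀ {v} → Inside v → v ∈ vertices
  vertices-complete {g , h} (g<m , h≤top) with h <? low g | high g <? h
  ... | yes h<low | _ =
    leg₁⊆vertices (low∈spine g<m) (there (subst ((g , h) ∈_) (sym (leg₁-low g)) (∈-map⁺ _ h∈)))
    where
    h∈ : h ∈ towards (low g) 0
    h∈ = ∈-towards⁺ _ _ (≤-trans (m⊓n≤n _ 0) z≤n) (≤-trans (<⇒≤ h<low) (m≤m⊔n _ 0)) (<⇒≢ h<low)
  ... | no _ | yes high<h =
    leg₂⊆vertices (high∈spine g<m) (there (subst ((g , h) ∈_) (sym (leg₂-high g)) (∈-map⁺ _ h∈)))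
    where
    h∈ : h ∈ towards (high g) top
    h∈ = ∈-towards⁺ _ _ (≤-trans (m⊓n≤m _ _) (<⇒≤ high<h)) (≤-trans h≤top (m≤n⊔m _ _)) (<⇒≢ high<h ∘ sym)
  ... | no h≮low | no high≮h =
    spine⊆vertices (segment⊆spineUpTo g<m (∈-map⁺ _ (∈-⋯⁺ _ _ (≮⇒≥ h≮low) (≮⇒≥ high≮h))))

  step-covered : ∀ {p q} → Step p q → Inside p → Inside q → Covers p q
  step-covered (vertical g z) (g<m , _) (_ , 1+z≤top) with z <? low g | suc z ≤? high g
  ... | yes z<low | _ = inj₂ ((g , low g) , low∈spine g<m , inj₁ on-leg)
    where
    on-leg : EdgeOfPath H ((g , low g) ∷ leg₁ (g , low g)) (g , z) (g , suc z)
    on-leg rewrite leg₁-low g = column-edge g (low g) 0 (≤-trans (m⊓n≤n _ 0) z≤n) (≤-trans z<low (m≤m⊔n _ 0))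
  ... | no z≮low | yes 1+z≤high =
    inj₁ (segment-edge⇒spineUpTo-edge g<m (column-edge g _ _ (≮⇒≥ z≮low) 1+z≤high))
  ... | no _ | no 1+z≰high = inj₂ ((g , high g) , high∈spine g<m , inj₂ on-leg)
    where
    on-leg : EdgeOfPath H ((g , high g) ∷ leg₂ (g , high g)) (g , z) (g , suc z)
    on-leg rewrite leg₂-high g =
      column-edge g (high g) top (≤-trans (m⊓n≤m _ _) (s≤s⁻¹ (≰⇒> 1+z≰high))) (≤-trans 1+z≤top (m≤n⊔m _ _))
  step-covered (crossing g) _ (1+g<m , _) = inj₁ (crossing-edge 1+g<m)

  edges-complete : ∀ {u v} → Inside u → Inside v → E H u v → Covers u v
  edges-complete inside-u inside-v e with step-view e
  ... | inj₁ s = step-covered s inside-u inside-v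
  ... | inj₂ s = Covers-sym (step-covered s inside-v inside-u)

  legSpine : 0 < m → LegSpine H Inside
  legSpine 0<m = record
    { spine             = spine
    ; leg₁              = leg₁
    ; leg₂              = leg₂
    ; spine-nonempty    = nonempty 0<m
    ; spine-path        = spineUpTo-linked m , spineUpTo-unique m
    ; legs-path         = λ {p} _ → leg₁-path p , leg₂-path p
    ; vertices-unique   = vertices-unique
    ; vertices-complete = vertices-complete
    ; edges-complete    = edges-complete
    }
    where
    nonempty : ∀ {k} → 0 < k → 1 ≤ length (spineUpTo k)
    nonempty {suc k} _ = s≤s z≤n

lemma4p3 : (m n : ℕ) → 2 ≤ n → 2 ≤ m → (f : Fin m → Fin n) →
    IsTree (Sierpinski (P m) (P n) f) × SpineDecomposition (Sierpinski (P m) (P n) f)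
lemma4p3 (suc m′) (suc n′) _ _ f =
  Ranking⇒IsTree (Ranking-pullback embedding ranking (λ {u} _ → in-range (parent-inside (inside u))))
                 (Sierpinski-sym f (P-sym (suc m′)) (P-sym (suc n′))) ,
  LegSpine⇒SpineDecomposition (LegSpine-pullback embedding (legSpine (s≤s z≤n)) inside (in-range ∘ vertices-inside))
  where
  F : ℕ → ℕ
  F g = toℕ (f (toFin g))

  open Model (suc m′) n′ F (λ g → toℕ≤pred[n] (f (toFin g)))

  embedding : Embedding (Sierpinski (P (suc m′)) (P (suc n′)) f) H
  embedding = Sierpinski-embedding (P-embedding m′) (P-embedding n′) f F (λ g → cong (toℕ ∘ f) (sym (toFin-toℕ g)))

  open Embedding embedding using (to; InRange)

  inside : ∀ v → Inside (to v)
  inside (g , h) = toℕ<n g , toℕ≤pred[n] h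

  in-range : ∀ {p} → Inside p → InRange p
  in-range (g<m , h≤n′) = cong₂ _,_ (toℕ-toFin g<m) (toℕ-toFin (s≤s h≤n′))
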